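{- If $\pi\in S_n$ is shallow, then the permutations $\pi^{ -1}$, $\pi^{rc}$ and $\pi^{rci}$ are also shallow.
   Context: For $\pi=\pi_1\cdots\pi_n \in S_n$: $D(\pi)=\sum_{i=1}^n|\pi_i-i|$; $I(\pi)=|\{(i,j): i<j,\ \pi_i>\pi_j\}|$; $T(\pi)=n-\mathrm{cyc}(\pi)$ where $\mathrm{cyc}(\pi)$ is the number of cycles of $\pi$. $\pi$ is shallow if $I(\pi)+T(\pi)=D(\pi)$. $\pi^{ -1}$ is the group-theoretic inverse. The reverse-complement $\pi^{rc}$ is defined by $\pi^{rc}_{n+1-i}=n+1-\pi_i$ for all $i$. The reverse-complement-inverse is $\pi^{rci}=(\pi^{rc})^{ -1}$. -}

module Defs where

open import Data.Nat using (ℕ; zero; suc; _+_; _∸_; _<_; _≤_; _<ᵇ_; _≤ᵇ_)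
open import Data.Bool using (Bool; true; false; if_then_else_; _∧_)
open import Data.Fin using (Fin; toℕ; opposite)
open import Data.Fin.Permutation using (Permutation′; _⟨$⟩ʳ_; flip; reverse; _∘ₚ_)
open import Data.List using (List; map; length; filter; allFin; upTo)
open import Data.Nat.ListAction using (sum)
open import Data.Bool.ListAction using (and)
open import Data.Product using (_×_; _,_)
open import Relation.Binary.PropositionalEquality using (_≡_)
open import Relation.Nullary.Decidable using (does)
open import Data.Fin.Properties using (_<?_)

-- Permutations of [n] = {0,…,n-1} (0-indexed), one-line notation π_i = π ⟨$⟩ʳ i.

dist : ℕ → ℕ → ℕ
dist a b = (a ∸ b) + (b ∸ a)

D : ∀ {n} → Permutation′ n → ℕ
D {n} π = sum (map (λ i → dist (toℕ (π ⟨$⟩ʳ i)) (toℕ i)) (allFin n))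

I : ∀ {n} → Permutation′ n → ℕ
I {n} π = length (filter (λ p → inv p) pairs)
  where
  pairs : List (Fin n × Fin n)
  pairs = Data.List.concatMap (λ i → map (λ j → (i , j)) (allFin n)) (allFin n)
  inv : (p : Fin n × Fin n) → _
  inv (i , j) = Relation.Nullary.Decidable._×-dec_ (i <? j) ((π ⟨$⟩ʳ j) <? (π ⟨$⟩ʳ i))

iter : ∀ {n} → Permutation′ n → ℕ → Fin n → Fin n
iter π zero i = i
iter π (suc k) i = π ⟨$⟩ʳ (iter π k i)

-- i is the least element of its cycle: every π^k(i), k < n, is ≥ i
-- (the cycle of i is {π^k(i) : k < n}).
isCycleMin : ∀ {n} → Permutation′ n → Fin n → Bool
isCycleMin {n} π i = and (map (λ k → toℕ i ≤ᵇ toℕ (iter π k i)) (upTo n))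

-- cyc(π) = number of cycles = number of cycle minima
cyc : ∀ {n} → Permutation′ n → ℕ
cyc {n} π = length (filter (λ i → Relation.Nullary.Decidable.T? (isCycleMin π i)) (allFin n))

T : ∀ {n} → Permutation′ n → ℕ
T {n} π = n ∸ cyc π

Shallow : ∀ {n} → Permutation′ n → Set
Shallow π = I π + T π ≡ D π

inv : ∀ {n} → Permutation′ n → Permutation′ n
inv π = flip π

-- reverse-complement: π^rc(opposite i) = opposite (π i), i.e. π^rc = rev ∘ π ∘ rev
rc : ∀ {n} → Permutation′ n → Permutation′ n
rc π = reverse ∘ₚ (π ∘ₚ reverse)

rci : ∀ {n} → Permutation′ n → Permutation′ n
rci π = inv (rc π)

{-# OPTIONS --safe #-}

-- The statistics I, D and cyc are each invariant under π ↦ π⁻¹ and under π ↦ π^rc, hence so is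
-- shallowness, and π^rci = (π^rc)⁻¹.  For I and D this is a reindexing of the defining sums:
-- (i, j) ↦ (π j, π i), resp. (i, j) ↦ (n−1−j, n−1−i), maps inversions of π onto inversions of the
-- image, and i ↦ π i, resp. i ↦ n−1−i, preserves displacements.  cyc counts cycle minima: π⁻¹ has the
-- same cycles as π, and reflecting by i ↦ n−1−i turns the cycle minima of π^rc into the cycle maxima
-- of π.  Any two rules choosing one element from each cycle choose equally many elements, as the
-- involution exchanging the two chosen elements of every cycle shows.

module Submission where

open import Defs
open import Level using (0ℓ)
open import Data.Nat as ℕ using (ℕ; zero; suc; _+_; _*_; _∸_; _≤_; _≤?_; _≤ᵇ_; _%_; _/_; s<s; NonZero)
open import Data.Nat.Properties
  using (+-comm; +-assoc; ≤-antisym; ≤-trans; <⇒≤; <-≤-trans; n<1+n; m∸n≤m; m∸n+n≡m; m+[n∸m]≡n; m≤m*n;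
         m<n⇒0<n∸m; ∸-monoʳ-<; [m+n]∸[m+o]≡n∸o; ≤ᵇ⇒≤; ≤⇒≤ᵇ; ≤-totalOrder; +-0-commutativeMonoid)
open import Data.Nat.DivMod using (m≡m%n+[m/n]*n; m%n<n)
open import Data.Nat.ListAction using (sum)
open import Data.Nat.ListAction.Properties using (sum-++)
open import Data.Bool using (Bool) renaming (T to True)
open import Data.Fin using (Fin; zero; suc; toℕ; opposite; _<_)
open import Data.Fin.Properties
  using (_<?_; toℕ-injective; toℕ<n; toℕ≤pred[n]; pigeonhole; opposite-prop; opposite-involutive)
open import Data.Fin.Permutation using (Permutation′; _⟨$⟩ʳ_; _⟨$⟩ˡ_; inverseˡ; reverse; permutation)
open import Data.List using (List; []; _∷_; _++_; map; length; filter; concatMap; tabulate; allFin; upTo)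
open import Data.List.Properties using (map-++; map-∘)
open import Data.List.Relation.Unary.All as All using (All; all?)
open import Data.List.Relation.Unary.All.Properties using (all⁺; all⁻)
open import Data.List.Membership.Propositional.Properties using (∈-upTo⁺)
open import Data.List.Extrema ≤-totalOrder using (argmin; f[argmin]≤f[xs])
open import Data.Product using (_×_; _,_; ∃-syntax)
open import Data.Product.Function.NonDependent.Propositional using (_×-⇔_)
open import Function using (_∘_; _⇔_; mk⇔; Equivalence)
open import Function.Definitions using (Injective)
import Function.Properties.Equivalence as ⇔
open import Relation.Binary.Core using (Rel)
open import Relation.Binary.Definitions using (Transitive)
open import Relation.Binary.PropositionalEquality
open import Relation.Nullary using (Dec; yes; no; ¬_; contradiction)
open import Relation.Nullary.Decidable using (_×-dec_; map′; T?)
open import Relation.Unary using (Pred; Decidable)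
open import Algebra.Properties.CommutativeMonoid.Sum +-0-commutativeMonoid
  using (sum-syntax; sum-cong-≗; sum-permute; ∑-comm)

open ≡-Reasoning

-- Finite sums and counting

iverson : ∀ {p} {P : Set p} → Dec P → ℕ
iverson (yes _) = 1
iverson (no _)  = 0

iverson-⇔ : ∀ {p q} {P : Set p} {Q : Set q} → P ⇔ Q → (P? : Dec P) (Q? : Dec Q) → iverson P? ≡ iverson Q?
iverson-⇔ P⇔Q (yes _) (yes _) = refl
iverson-⇔ P⇔Q (yes p) (no ¬q) = contradiction (Equivalence.to P⇔Q p) ¬q
iverson-⇔ P⇔Q (no ¬p) (yes q) = contradiction (Equivalence.from P⇔Q q) ¬p
iverson-⇔ P⇔Q (no _)  (no _)  = refl

count : ∀ {n} {P : Pred (Fin n) 0ℓ} → Decidable P → ℕ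
count {n} P? = ∑[ i < n ] iverson (P? i)

length-filter≡sum-iverson : ∀ {a p} {A : Set a} {P : Pred A p} (P? : Decidable P) (xs : List A) →
  length (filter P? xs) ≡ sum (map (iverson ∘ P?) xs)
length-filter≡sum-iverson P? [] = refl
length-filter≡sum-iverson P? (x ∷ xs) with P? x
... | yes _ = cong suc (length-filter≡sum-iverson P? xs)
... | no  _ = length-filter≡sum-iverson P? xs

sum-map-concatMap : ∀ {a b} {A : Set a} {B : Set b} (f : B → ℕ) (g : A → List B) (xs : List A) →
  sum (map f (concatMap g xs)) ≡ sum (map (sum ∘ map f ∘ g) xs)
sum-map-concatMap f g [] = refl
sum-map-concatMap f g (x ∷ xs) = begin
  sum (map f (g x ++ concatMap g xs))             ≡⟨ cong sum (map-++ f (g x) _) ⟩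
  sum (map f (g x) ++ map f (concatMap g xs))     ≡⟨ sum-++ (map f (g x)) _ ⟩
  sum (map f (g x)) + sum (map f (concatMap g xs)) ≡⟨ cong (sum (map f (g x)) +_) (sum-map-concatMap f g xs) ⟩
  sum (map (sum ∘ map f ∘ g) (x ∷ xs))            ∎

sum-map-tabulate : ∀ {a n} {A : Set a} (f : A → ℕ) (g : Fin n → A) →
  sum (map f (tabulate g)) ≡ ∑[ i < n ] f (g i)
sum-map-tabulate {n = zero}  f g = refl
sum-map-tabulate {n = suc n} f g = cong (f (g zero) +_) (sum-map-tabulate f (g ∘ suc))

sum-map-allFin : ∀ {n} (f : Fin n → ℕ) → sum (map f (allFin n)) ≡ ∑[ i < n ] f i
sum-map-allFin f = sum-map-tabulate f (λ i → i)

∑∑-permute-swap : ∀ {n} (τ : Permutation′ n) (f : Fin n → Fin n → ℕ) →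
  ∑[ i < n ] ∑[ j < n ] f i j ≡ ∑[ a < n ] ∑[ b < n ] f (τ ⟨$⟩ʳ b) (τ ⟨$⟩ʳ a)
∑∑-permute-swap {n} τ f = begin
  ∑[ i < n ] ∑[ j < n ] f i j                     ≡⟨ sum-permute _ τ ⟩
  ∑[ a < n ] ∑[ j < n ] f (τ ⟨$⟩ʳ a) j            ≡⟨ sum-cong-≗ (λ a → sum-permute (f (τ ⟨$⟩ʳ a)) τ) ⟩
  ∑[ a < n ] ∑[ b < n ] f (τ ⟨$⟩ʳ a) (τ ⟨$⟩ʳ b)   ≡⟨ ∑-comm (λ a b → f (τ ⟨$⟩ʳ a) (τ ⟨$⟩ʳ b)) ⟩
  ∑[ b < n ] ∑[ a < n ] f (τ ⟨$⟩ʳ a) (τ ⟨$⟩ʳ b)   ∎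

record Transversal {n} (_~_ : Rel (Fin n) 0ℓ) (P : Pred (Fin n) 0ℓ) : Set where
  field
    rep    : Fin n → Fin n
    P-rep  : ∀ x → P (rep x)
    ~-rep  : ∀ x → x ~ rep x
    unique : ∀ {x y} → P x → P y → x ~ y → x ≡ y

module _ {n} {_~_ : Rel (Fin n) 0ℓ} (~-trans : Transitive _~_)
         {P Q : Pred (Fin n) 0ℓ} (P? : Decidable P) (Q? : Decidable Q)
         (𝒫 : Transversal _~_ P) (𝒬 : Transversal _~_ Q) where

  open Transversal 𝒫 renaming (rep to p; P-rep to P-p; ~-rep to ~-p; unique to P-unique)
  open Transversal 𝒬 renaming (rep to q; P-rep to Q-q; ~-rep to ~-q; unique to Q-unique)

  swap : Fin n → Fin n
  swap x with P? x | Q? x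
  ... | yes _ | _     = q x
  ... | no _  | yes _ = p x
  ... | no _  | no _  = x

  swap-P : ∀ {x} → P x → swap x ≡ q x
  swap-P {x} Px with P? x
  ... | yes _  = refl
  ... | no ¬Px = contradiction Px ¬Px

  swap-Q : ∀ {x} → Q x → swap x ≡ p x
  swap-Q {x} Qx with P? x | Q? x
  ... | yes Px | _      = trans (sym (Q-unique Qx (Q-q x) (~-q x))) (P-unique Px (P-p x) (~-p x))
  ... | no _   | yes _  = refl
  ... | no _   | no ¬Qx = contradiction Qx ¬Qx

  swap-other : ∀ {x} → ¬ P x → ¬ Q x → swap x ≡ x
  swap-other {x} ¬Px ¬Qx with P? x | Q? x
  ... | yes Px | _     = contradiction Px ¬Px
  ... | no _   | yes Qx = contradiction Qx ¬Qx
  ... | no _   | no _  = refl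

  swap-involutive : ∀ x → swap (swap x) ≡ x
  swap-involutive x = by-cases (P? x) (Q? x)
    where
    by-cases : Dec (P x) → Dec (Q x) → swap (swap x) ≡ x
    by-cases (yes Px) _ = begin
      swap (swap x) ≡⟨ cong swap (swap-P Px) ⟩
      swap (q x)    ≡⟨ swap-Q (Q-q x) ⟩
      p (q x)       ≡⟨ P-unique Px (P-p (q x)) (~-trans (~-q x) (~-p (q x))) ⟨
      x             ∎
    by-cases (no _) (yes Qx) = begin
      swap (swap x) ≡⟨ cong swap (swap-Q Qx) ⟩
      swap (p x)    ≡⟨ swap-P (P-p x) ⟩
      q (p x)       ≡⟨ Q-unique Qx (Q-q (p x)) (~-trans (~-p x) (~-q (p x))) ⟨
      x             ∎
    by-cases (no ¬Px) (no ¬Qx) = trans (cong swap (swap-other ¬Px ¬Qx)) (swap-other ¬Px ¬Qx)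

  P∘swap⇔Q : ∀ x → P (swap x) ⇔ Q x
  P∘swap⇔Q x = mk⇔ to (λ Qx → subst P (sym (swap-Q Qx)) (P-p x))
    where
    to : P (swap x) → Q x
    to P[swap-x] with P? x | Q? x
    ... | _      | yes Qx = Qx
    ... | yes Px | no _   = subst Q (sym (P-unique Px P[swap-x] (~-q x))) (Q-q x)
    ... | no ¬Px | no ¬Qx = contradiction P[swap-x] ¬Px

  count-transversals : count P? ≡ count Q?
  count-transversals = begin
    ∑[ x < n ] iverson (P? x)        ≡⟨ sum-permute _ (permutation swap swap swap-involutive swap-involutive) ⟩
    ∑[ x < n ] iverson (P? (swap x)) ≡⟨ sum-cong-≗ (λ x → iverson-⇔ (P∘swap⇔Q x) (P? (swap x)) (Q? x)) ⟩
    ∑[ x < n ] iverson (Q? x)        ∎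

-- Inversions and displacements

dist-comm : ∀ a b → dist a b ≡ dist b a
dist-comm a b = +-comm (a ∸ b) (b ∸ a)

dist-+ˡ : ∀ m a b → dist (m + a) (m + b) ≡ dist a b
dist-+ˡ m a b = cong₂ _+_ ([m+n]∸[m+o]≡n∸o m a b) ([m+n]∸[m+o]≡n∸o m b a)

dist-complement : ∀ a a′ b b′ {c} → a′ + a ≡ c → b′ + b ≡ c → dist a′ b′ ≡ dist a b
dist-complement a a′ b b′ {c} a′+a≡c b′+b≡c = begin
  dist a′ b′                           ≡⟨ dist-+ˡ (a + b) a′ b′ ⟨
  dist (a + b + a′) (a + b + b′)       ≡⟨ cong₂ dist (trans (+-comm (a + b) a′) (sym (+-assoc a′ a b)))
                                                     (trans (+-comm (a + b) b′) (cong (b′ +_) (+-comm a b))) ⟩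
  dist (a′ + a + b) (b′ + (b + a))     ≡⟨ cong₂ dist (cong (_+ b) a′+a≡c)
                                                     (trans (sym (+-assoc b′ b a)) (cong (_+ a) b′+b≡c)) ⟩
  dist (c + b) (c + a)                 ≡⟨ dist-+ˡ c b a ⟩
  dist b a                             ≡⟨ dist-comm b a ⟩
  dist a b                             ∎

toℕ-opposite-+ : ∀ {n} (i : Fin n) → toℕ (opposite i) + suc (toℕ i) ≡ n
toℕ-opposite-+ i = trans (cong (_+ suc (toℕ i)) (opposite-prop i)) (m∸n+n≡m (toℕ<n i))

dist-opposite : ∀ {n} (i j : Fin n) → dist (toℕ (opposite i)) (toℕ (opposite j)) ≡ dist (toℕ i) (toℕ j)
dist-opposite i j =
  dist-complement _ (toℕ (opposite i)) _ (toℕ (opposite j)) (toℕ-opposite-+ i) (toℕ-opposite-+ j)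

opposite-injective : ∀ {n} → Injective _≡_ _≡_ (opposite {n})
opposite-injective {x = x} {y} eq =
  trans (sym (opposite-involutive x)) (trans (cong opposite eq) (opposite-involutive y))

opposite-< : ∀ {n} {i j : Fin n} → i < j → opposite j < opposite i
opposite-< {i = i} {j} i<j rewrite opposite-prop i | opposite-prop j = ∸-monoʳ-< (s<s i<j) (toℕ<n j)

<⇔opposite-> : ∀ {n} {i j : Fin n} → i < j ⇔ opposite j < opposite i
<⇔opposite-> {i = i} {j} = mk⇔ opposite-<
  (λ h → subst₂ _<_ (opposite-involutive i) (opposite-involutive j) (opposite-< h))

rc-opposite : ∀ {n} (π : Permutation′ n) (i : Fin n) → rc π ⟨$⟩ʳ opposite i ≡ opposite (π ⟨$⟩ʳ i)
rc-opposite π i = cong (opposite ∘ (π ⟨$⟩ʳ_)) (opposite-involutive i)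

Inversion : ∀ {n} → Permutation′ n → Fin n → Fin n → Set
Inversion π i j = i < j × π ⟨$⟩ʳ j < π ⟨$⟩ʳ i

inversion? : ∀ {n} (π : Permutation′ n) (i j : Fin n) → Dec (Inversion π i j)
inversion? π i j = (i <? j) ×-dec (π ⟨$⟩ʳ j <? π ⟨$⟩ʳ i)

I≡∑-inversions : ∀ {n} (π : Permutation′ n) → I π ≡ ∑[ i < n ] ∑[ j < n ] iverson (inversion? π i j)
I≡∑-inversions {n} π = begin
  I π
    ≡⟨ length-filter≡sum-iverson _ (concatMap row (allFin n)) ⟩
  sum (map ι (concatMap row (allFin n)))
    ≡⟨ sum-map-concatMap ι row (allFin n) ⟩
  sum (map (sum ∘ map ι ∘ row) (allFin n))
    ≡⟨ sum-map-allFin (sum ∘ map ι ∘ row) ⟩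
  ∑[ i < n ] sum (map ι (row i))
    ≡⟨ sum-cong-≗ (λ i → cong sum (map-∘ {g = ι} {f = i ,_} (allFin n))) ⟨
  ∑[ i < n ] sum (map (ι ∘ (i ,_)) (allFin n))
    ≡⟨ sum-cong-≗ (λ i → sum-map-allFin (ι ∘ (i ,_))) ⟩
  ∑[ i < n ] ∑[ j < n ] iverson (inversion? π i j)
    ∎
  where
  row : Fin n → List (Fin n × Fin n)
  row i = map (i ,_) (allFin n)
  ι : Fin n × Fin n → ℕ
  ι (i , j) = iverson (inversion? π i j)

I-reindex : ∀ {n} (π′ π τ : Permutation′ n) →
  (∀ a b → Inversion π′ (τ ⟨$⟩ʳ b) (τ ⟨$⟩ʳ a) ⇔ Inversion π a b) → I π′ ≡ I π
I-reindex {n} π′ π τ inversions⇔ = begin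
  I π′
    ≡⟨ I≡∑-inversions π′ ⟩
  ∑[ i < n ] ∑[ j < n ] iverson (inversion? π′ i j)
    ≡⟨ ∑∑-permute-swap τ _ ⟩
  ∑[ a < n ] ∑[ b < n ] iverson (inversion? π′ (τ ⟨$⟩ʳ b) (τ ⟨$⟩ʳ a))
    ≡⟨ sum-cong-≗ (λ a → sum-cong-≗ (λ b → iverson-⇔ (inversions⇔ a b) _ (inversion? π a b))) ⟩
  ∑[ a < n ] ∑[ b < n ] iverson (inversion? π a b)
    ≡⟨ I≡∑-inversions π ⟨
  I π
    ∎

displacement : ∀ {n} → Permutation′ n → Fin n → ℕ
displacement π i = dist (toℕ (π ⟨$⟩ʳ i)) (toℕ i)

D-reindex : ∀ {n} (π′ π τ : Permutation′ n) → (∀ a → displacement π′ (τ ⟨$⟩ʳ a) ≡ displacement π a) → D π′ ≡ D π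
D-reindex {n} π′ π τ displacements≡ = begin
  D π′
    ≡⟨ sum-map-allFin (displacement π′) ⟩
  ∑[ i < n ] displacement π′ i
    ≡⟨ sum-permute (displacement π′) τ ⟩
  ∑[ a < n ] displacement π′ (τ ⟨$⟩ʳ a)
    ≡⟨ sum-cong-≗ displacements≡ ⟩
  ∑[ a < n ] displacement π a
    ≡⟨ sum-map-allFin (displacement π) ⟨
  D π
    ∎

-- Cycles

module _ {n} (π : Permutation′ n) where

  iter-suc : ∀ k x → iter π (suc k) x ≡ iter π k (π ⟨$⟩ʳ x)
  iter-suc zero    x = refl
  iter-suc (suc k) x = cong (π ⟨$⟩ʳ_) (iter-suc k x)

  iter-+ : ∀ a b x → iter π (a + b) x ≡ iter π a (iter π b x)
  iter-+ zero    b x = refl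
  iter-+ (suc a) b x = cong (π ⟨$⟩ʳ_) (iter-+ a b x)

  iter-* : ∀ {m x} → iter π m x ≡ x → ∀ q → iter π (q * m) x ≡ x
  iter-* πᵐx≡x zero = refl
  iter-* {m} {x} πᵐx≡x (suc q) =
    trans (iter-+ m (q * m) x) (trans (cong (iter π m) (iter-* πᵐx≡x q)) πᵐx≡x)

iter-inv-cancel : ∀ {n} (π : Permutation′ n) k x → iter (inv π) k (iter π k x) ≡ x
iter-inv-cancel π zero    x = refl
iter-inv-cancel π (suc k) x = begin
  iter (inv π) (suc k) (iter π (suc k) x)     ≡⟨ iter-suc (inv π) k _ ⟩
  iter (inv π) k (π ⟨$⟩ˡ (π ⟨$⟩ʳ iter π k x)) ≡⟨ cong (iter (inv π) k) (inverseˡ π) ⟩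
  iter (inv π) k (iter π k x)                 ≡⟨ iter-inv-cancel π k x ⟩
  x                                           ∎

module _ {n} (π : Permutation′ n) where

  iter-injective : ∀ k {x y} → iter π k x ≡ iter π k y → x ≡ y
  iter-injective k {x} {y} πᵏx≡πᵏy = begin
    x                           ≡⟨ iter-inv-cancel π k x ⟨
    iter (inv π) k (iter π k x) ≡⟨ cong (iter (inv π) k) πᵏx≡πᵏy ⟩
    iter (inv π) k (iter π k y) ≡⟨ iter-inv-cancel π k y ⟩
    y                           ∎

  iter-collision : ∀ {a b x} → a ≤ b → iter π a x ≡ iter π b x → iter π (b ∸ a) x ≡ x
  iter-collision {a} {b} {x} a≤b πᵃx≡πᵇx = sym (iter-injective a (begin
    iter π a x                  ≡⟨ πᵃx≡πᵇx ⟩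
    iter π b x                  ≡⟨ cong (λ k → iter π k x) (m+[n∸m]≡n a≤b) ⟨
    iter π (a + (b ∸ a)) x      ≡⟨ iter-+ π a (b ∸ a) x ⟩
    iter π a (iter π (b ∸ a) x) ∎))

  -- Two of the n + 1 points x, π x, …, πⁿ x coincide.
  period : ∀ x → ∃[ p ] suc p ≤ n × iter π (suc p) x ≡ x
  period x with pigeonhole (n<1+n n) (λ k → iter π (toℕ k) x)
  ... | a , b , a<b , πᵃx≡πᵇx = positive (m<n⇒0<n∸m a<b)
    (≤-trans (m∸n≤m (toℕ b) (toℕ a)) (toℕ≤pred[n] b)) (iter-collision (<⇒≤ a<b) πᵃx≡πᵇx)
    where
    positive : ∀ {d} → 0 ℕ.< d → d ≤ n → iter π d x ≡ x → ∃[ p ] suc p ≤ n × iter π (suc p) x ≡ x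
    positive {suc p} _ d≤n πᵈx≡x = p , d≤n , πᵈx≡x

  iter-% : ∀ {m x} .{{_ : NonZero m}} → iter π m x ≡ x → ∀ k → iter π k x ≡ iter π (k % m) x
  iter-% {m} {x} πᵐx≡x k = begin
    iter π k x                               ≡⟨ cong (λ j → iter π j x) (m≡m%n+[m/n]*n k m) ⟩
    iter π (k % m + k / m * m) x             ≡⟨ iter-+ π (k % m) (k / m * m) x ⟩
    iter π (k % m) (iter π (k / m * m) x)    ≡⟨ cong (iter π (k % m)) (iter-* π πᵐx≡x (k / m)) ⟩
    iter π (k % m) x                         ∎

  iter-bounded : ∀ k x → ∃[ k′ ] k′ ℕ.< n × iter π k x ≡ iter π k′ x
  iter-bounded k x with period x
  ... | p , 1+p≤n , πᵖ⁺¹x≡x = k % suc p , <-≤-trans (m%n<n k (suc p)) 1+p≤n , iter-% πᵖ⁺¹x≡x k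

  all-iterates : ∀ {Q : Pred (Fin n) 0ℓ} x → All (λ k → Q (iter π k x)) (upTo n) → ∀ k → Q (iter π k x)
  all-iterates {Q} x Qᵢ k with iter-bounded k x
  ... | k′ , k′<n , πᵏx≡πᵏ′x = subst Q (sym πᵏx≡πᵏ′x) (All.lookup Qᵢ (∈-upTo⁺ k′<n))

SameCycle : ∀ {n} → Permutation′ n → Rel (Fin n) 0ℓ
SameCycle π x y = ∃[ k ] iter π k x ≡ y

module _ {n} (π : Permutation′ n) where

  SameCycle-trans : Transitive (SameCycle π)
  SameCycle-trans {x} (k , refl) (l , refl) = l + k , iter-+ π l k x

  SameCycle-sym : ∀ {x y} → SameCycle π x y → SameCycle π y x
  SameCycle-sym {x} (k , refl) with period π x
  ... | p , _ , πᵖ⁺¹x≡x = k * suc p ∸ k , (begin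
    iter π (k * suc p ∸ k) (iter π k x) ≡⟨ iter-+ π (k * suc p ∸ k) k x ⟨
    iter π (k * suc p ∸ k + k) x        ≡⟨ cong (λ j → iter π j x) (m∸n+n≡m (m≤m*n k (suc p))) ⟩
    iter π (k * suc p) x                ≡⟨ iter-* π πᵖ⁺¹x≡x k ⟩
    x                                   ∎)

  SameCycle-inv : ∀ {x y} → SameCycle π x y → SameCycle (inv π) x y
  SameCycle-inv x~y with SameCycle-sym x~y
  ... | k , refl = k , iter-inv-cancel π k _

IsCycleLeast : ∀ {n} → (Fin n → ℕ) → Permutation′ n → Pred (Fin n) 0ℓ
IsCycleLeast r π x = ∀ k → r x ≤ r (iter π k x)

module _ {n} (r : Fin n → ℕ) (π : Permutation′ n) where

  isCycleLeast? : Decidable (IsCycleLeast r π)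
  isCycleLeast? x = map′ (all-iterates π {λ y → r x ≤ r y} x) (λ least → All.tabulate (λ {k} _ → least k))
                         (all? (λ k → r x ≤? r (iter π k x)) (upTo n))

  cycleLeast-≤ : ∀ {x y} → IsCycleLeast r π x → SameCycle π x y → r x ≤ r y
  cycleLeast-≤ least (k , refl) = least k

  cycleLeast-transversal : Injective _≡_ _≡_ r → Transversal (SameCycle π) (IsCycleLeast r π)
  cycleLeast-transversal r-injective = record
    { rep    = λ x → iter π (leastExponent x) x
    ; P-rep  = P-rep
    ; ~-rep  = λ x → leastExponent x , refl
    ; unique = λ Px Py x~y →
        r-injective (≤-antisym (cycleLeast-≤ Px x~y) (cycleLeast-≤ Py (SameCycle-sym π x~y)))
    }
    where
    leastExponent : Fin n → ℕ
    leastExponent x = argmin (λ k → r (iter π k x)) 0 (upTo n)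

    P-rep : ∀ x → IsCycleLeast r π (iter π (leastExponent x) x)
    P-rep x k = subst (λ y → r (iter π k₀ x) ≤ r y) (iter-+ π k k₀ x)
      (all-iterates π {λ y → r (iter π k₀ x) ≤ r y} x (f[argmin]≤f[xs] 0 (upTo n)) (k + k₀))
      where k₀ = leastExponent x

count-cycleLeast-rank-invariant : ∀ {n} {r s : Fin n → ℕ} (π : Permutation′ n) →
  Injective _≡_ _≡_ r → Injective _≡_ _≡_ s → count (isCycleLeast? r π) ≡ count (isCycleLeast? s π)
count-cycleLeast-rank-invariant π r-injective s-injective =
  count-transversals (SameCycle-trans π) (isCycleLeast? _ π) (isCycleLeast? _ π)
    (cycleLeast-transversal _ π r-injective) (cycleLeast-transversal _ π s-injective)

isCycleMin⇔IsCycleLeast : ∀ {n} (π : Permutation′ n) (x : Fin n) → True (isCycleMin π x) ⇔ IsCycleLeast toℕ π x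
isCycleMin⇔IsCycleLeast {n} π x = mk⇔
  (λ t → all-iterates π {λ y → toℕ x ≤ toℕ y} x (All.map (≤ᵇ⇒≤ _ _) (all⁺ test (upTo n) t)))
  (λ least → all⁻ test {upTo n} (All.tabulate (λ {k} _ → ≤⇒≤ᵇ (least k))))
  where
  test : ℕ → Bool
  test k = toℕ x ≤ᵇ toℕ (iter π k x)

cyc≡count-cycleLeast : ∀ {n} (π : Permutation′ n) → cyc π ≡ count (isCycleLeast? toℕ π)
cyc≡count-cycleLeast {n} π = begin
  cyc π
    ≡⟨ length-filter≡sum-iverson _ (allFin n) ⟩
  sum (map (iverson ∘ isCycleMin?) (allFin n))
    ≡⟨ sum-map-allFin (iverson ∘ isCycleMin?) ⟩
  ∑[ x < n ] iverson (isCycleMin? x)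
    ≡⟨ sum-cong-≗ (λ x → iverson-⇔ (isCycleMin⇔IsCycleLeast π x) (isCycleMin? x) (isCycleLeast? toℕ π x)) ⟩
  count (isCycleLeast? toℕ π)
    ∎
  where
  isCycleMin? : ∀ x → Dec (True (isCycleMin π x))
  isCycleMin? x = T? (isCycleMin π x)

IsCycleLeast-inv : ∀ {n} (r : Fin n → ℕ) (π : Permutation′ n) {x} → IsCycleLeast r π x → IsCycleLeast r (inv π) x
IsCycleLeast-inv r π least k = cycleLeast-≤ r π least (SameCycle-inv (inv π) (k , refl))

module _ {n} (ρ π : Permutation′ n) (τ : Fin n → Fin n) (ρτ≡τπ : ∀ x → ρ ⟨$⟩ʳ τ x ≡ τ (π ⟨$⟩ʳ x)) where

  iter-intertwine : ∀ k x → iter ρ k (τ x) ≡ τ (iter π k x)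
  iter-intertwine zero    x = refl
  iter-intertwine (suc k) x = trans (cong (ρ ⟨$⟩ʳ_) (iter-intertwine k x)) (ρτ≡τπ (iter π k x))

  IsCycleLeast-intertwine : ∀ (r : Fin n → ℕ) x → IsCycleLeast r ρ (τ x) ⇔ IsCycleLeast (r ∘ τ) π x
  IsCycleLeast-intertwine r x = mk⇔
    (λ least k → subst (λ y → r (τ x) ≤ r y) (iter-intertwine k x) (least k))
    (λ least k → subst (λ y → r (τ x) ≤ r y) (sym (iter-intertwine k x)) (least k))

-- Invariance under inversion and reverse-complement

module _ {n} (π : Permutation′ n) where

  I-inv : I (inv π) ≡ I π
  I-inv = I-reindex (inv π) π π λ a b → mk⇔
    (λ (πb<πa , a<b) → subst₂ _<_ (inverseˡ π) (inverseˡ π) a<b , πb<πa)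
    (λ (a<b , πb<πa) → πb<πa , subst₂ _<_ (sym (inverseˡ π)) (sym (inverseˡ π)) a<b)

  D-inv : D (inv π) ≡ D π
  D-inv = D-reindex (inv π) π π λ a →
    trans (cong (λ x → dist (toℕ x) _) (inverseˡ π)) (dist-comm (toℕ a) (toℕ (π ⟨$⟩ʳ a)))

  cyc-inv : cyc (inv π) ≡ cyc π
  cyc-inv = begin
    cyc (inv π)
      ≡⟨ cyc≡count-cycleLeast (inv π) ⟩
    count (isCycleLeast? toℕ (inv π))
      ≡⟨ sum-cong-≗ (λ x → iverson-⇔ (mk⇔ (IsCycleLeast-inv toℕ (inv π)) (IsCycleLeast-inv toℕ π))
                                     (isCycleLeast? toℕ (inv π) x) (isCycleLeast? toℕ π x)) ⟩
    count (isCycleLeast? toℕ π)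
      ≡⟨ cyc≡count-cycleLeast π ⟨
    cyc π
      ∎

  I-rc : I (rc π) ≡ I π
  I-rc = I-reindex (rc π) π reverse λ a b →
    subst₂ (λ u v → (opposite b < opposite a × u < v) ⇔ Inversion π a b)
           (sym (rc-opposite π a)) (sym (rc-opposite π b))
           (⇔.sym (<⇔opposite-> ×-⇔ <⇔opposite->))

  D-rc : D (rc π) ≡ D π
  D-rc = D-reindex (rc π) π reverse λ a →
    trans (cong (λ x → dist (toℕ x) (toℕ (opposite a))) (rc-opposite π a)) (dist-opposite (π ⟨$⟩ʳ a) a)

  cyc-rc : cyc (rc π) ≡ cyc π
  cyc-rc = begin
    cyc (rc π)
      ≡⟨ cyc≡count-cycleLeast (rc π) ⟩
    count (isCycleLeast? toℕ (rc π))
      ≡⟨ sum-permute (iverson ∘ isCycleLeast? toℕ (rc π)) reverse ⟩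
    ∑[ x < n ] iverson (isCycleLeast? toℕ (rc π) (opposite x))
      ≡⟨ sum-cong-≗ (λ x → iverson-⇔ (IsCycleLeast-intertwine (rc π) π opposite (rc-opposite π) toℕ x)
                                     (isCycleLeast? toℕ (rc π) (opposite x)) (isCycleLeast? (toℕ ∘ opposite) π x)) ⟩
    count (isCycleLeast? (toℕ ∘ opposite) π)
      ≡⟨ count-cycleLeast-rank-invariant π (opposite-injective ∘ toℕ-injective) toℕ-injective ⟩
    count (isCycleLeast? toℕ π)
      ≡⟨ cyc≡count-cycleLeast π ⟨
    cyc π
      ∎

shallow-transfer : ∀ {n} (π σ : Permutation′ n) → I σ ≡ I π → cyc σ ≡ cyc π → D σ ≡ D π → Shallow π → Shallow σ
shallow-transfer π σ I≡ cyc≡ D≡ shallow rewrite I≡ | cyc≡ | D≡ = shallow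

shallow-inv : ∀ {n} (π : Permutation′ n) → Shallow π → Shallow (inv π)
shallow-inv π = shallow-transfer π (inv π) (I-inv π) (cyc-inv π) (D-inv π)

shallow-rc : ∀ {n} (π : Permutation′ n) → Shallow π → Shallow (rc π)
shallow-rc π = shallow-transfer π (rc π) (I-rc π) (cyc-rc π) (D-rc π)

proposition2p2 : ∀ (n : ℕ) (π : Permutation′ n) → Shallow π →
    Shallow (inv π) × Shallow (rc π) × Shallow (rci π)
proposition2p2 n π shallow =
  shallow-inv π shallow , shallow-rc π shallow , shallow-inv (rc π) (shallow-rc π shallow)
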